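{- Let $X_1,X_2,X_3,X_4$ be pairwise disjoint vertex subsets of $G_3$ with $V(G_3)=X_1\cup X_2\cup X_3\cup X_4$ and $|X_1|\ge|X_2|\ge|X_3|\ge|X_4|>0$. Then $\sum_{1\le i<j\le 4}e(X_i,X_j)\ge 7$, and if equality holds then one of the following holds: (i) $e(X_i,X_j)>0$ for all $1\le i<j\le 4$; (ii) $|X_1|=5$ and there exist $2\le\alpha<\beta\le 4$ such that $e(X_\alpha,X_\beta)=0$ and $e(X_i,X_j)>0$ for all $1\le i<j\le 4$ with $(i,j)\ne(\alpha,\beta)$.
   Context: $G_3$ is the 3-dimensional locally twisted cube: vertex set $\{0,1\}^3$ and the 12 edges $000\text{ - }001$, $001\text{ - }011$, $011\text{ - }010$, $010\text{ - }000$, $100\text{ - }101$, $101\text{ - }111$, $111\text{ - }110$, $110\text{ - }100$, $000\text{ - }100$, $010\text{ - }110$, $001\text{ - }111$, $011\text{ - }101$. For vertex sets $X,Y$, $e(X,Y)$ is the number of edges with one end in $X$ and the other in $Y$. -}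

module Defs where

open import Data.Nat using (ℕ; zero; suc; _+_)
open import Data.Bool using (Bool; true; false; _∧_; _∨_; if_then_else_)
open import Data.Fin using (Fin)
open import Data.Fin.Subset using (Subset; _∈_; _∉_; ⊤)
open import Data.Fin.Subset.Properties using (_∈?_)
open import Data.Vec using (Vec; []; _∷_)
open import Data.List using (List; []; _∷_; length; filter)
open import Data.Product using (_×_; _,_)
open import Relation.Nullary using (Dec; yes; no; does)

Vertex : Set
Vertex = Vec Bool 3

v : Bool → Bool → Bool → Vertex
v a b c = a ∷ b ∷ c ∷ []

-- Encode a vertex b₁b₂b₃ as the element 4b₁+2b₂+b₃ of Fin 8, so that
-- vertex subsets are Data.Fin.Subset 8.
bit : Bool → ℕ
bit true = 1
bit false = 0

enc : Vertex → Fin 8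
enc (a ∷ b ∷ c ∷ []) = Data.Fin.fromℕ< {bit a + bit a + bit a + bit a + bit b + bit b + bit c} (bnd a b c)
  where
  open import Data.Nat using (_<_; s≤s; z≤n)
  bnd : (a b c : Bool) → bit a + bit a + bit a + bit a + bit b + bit b + bit c < 8
  bnd false false false = s≤s z≤n
  bnd false false true  = s≤s (s≤s z≤n)
  bnd false true  false = s≤s (s≤s (s≤s z≤n))
  bnd false true  true  = s≤s (s≤s (s≤s (s≤s z≤n)))
  bnd true  false false = s≤s (s≤s (s≤s (s≤s (s≤s z≤n))))
  bnd true  false true  = s≤s (s≤s (s≤s (s≤s (s≤s (s≤s z≤n)))))
  bnd true  true  false = s≤s (s≤s (s≤s (s≤s (s≤s (s≤s (s≤s z≤n))))))
  bnd true  true  true  = s≤s (s≤s (s≤s (s≤s (s≤s (s≤s (s≤s (s≤s z≤n)))))))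

VSet : Set
VSet = Subset 8

-- The 12 edges of the 3-dimensional locally twisted cube G_3.
edges : List (Vertex × Vertex)
edges =
  (v false false false , v false false true) ∷
  (v false false true  , v false true  true) ∷
  (v false true  true  , v false true  false) ∷
  (v false true  false , v false false false) ∷
  (v true  false false , v true  false true) ∷
  (v true  false true  , v true  true  true) ∷
  (v true  true  true  , v true  true  false) ∷
  (v true  true  false , v true  false false) ∷
  (v false false false , v true  false false) ∷
  (v false true  false , v true  true  false) ∷
  (v false false true  , v true  true  true) ∷
  (v false true  true  , v true  false true) ∷
  []

mem : Vertex → VSet → Bool
mem x X = does (enc x ∈? X)

crosses : VSet → VSet → Vertex × Vertex → Bool
crosses X Y (a , b) = (mem a X ∧ mem b Y) ∨ (mem a Y ∧ mem b X)

e : VSet → VSet → ℕ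
e X Y = count edges
  where
  count : List (Vertex × Vertex) → ℕ
  count [] = 0
  count (p ∷ ps) = (if crosses X Y p then 1 else 0) + count ps

-- X_i for i = 1,2,3,4 (1-based, as in the paper); other indices unused.
part : VSet → VSet → VSet → VSet → ℕ → VSet
part X₁ X₂ X₃ X₄ 1 = X₁
part X₁ X₂ X₃ X₄ 2 = X₂
part X₁ X₂ X₃ X₄ 3 = X₃
part X₁ X₂ X₃ X₄ _ = X₄

sumE : VSet → VSet → VSet → VSet → ℕ
sumE X₁ X₂ X₃ X₄ =
  e X₁ X₂ + e X₁ X₃ + e X₁ X₄ + e X₂ X₃ + e X₂ X₄ + e X₃ X₄

module Submission where

-- Four pairwise disjoint sets covering the vertex set {0,1}³
-- are exactly the colour classes of a colouring of the eight vertices with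
-- four colours (partition⇒colouring).  There are only 4⁸ such colourings,
-- so the lemma is proved by exhaustive verification, run by the type checker.
--
-- To make the verification a decision procedure, the conclusion is recast in
-- a finite form (module Quadruple): the quantifier over pairs 1 ≤ i < j ≤ 4
-- becomes the six explicit pairs (six⇒allPairs), and the existential over
-- (α, β) a choice among (2,3), (2,4), (3,4) (finite⇒conclusion).

open import Defs
open import Data.Nat using (ℕ; _≤_; _<_; _≥_; _>_)
open import Data.Fin.Subset using (Subset; ⊤; ⊥; _∩_; _∪_; ∣_∣)
open import Data.Product using (_×_; ∃-syntax)
open import Data.Sum using (_⊎_)
open import Relation.Nullary using (¬_)
open import Relation.Binary.PropositionalEquality using (_≡_)

open import Data.Nat using (zero; suc; z≤n; s≤s)
open import Data.Nat.Properties using (_≟_; _≤?_; _<?_; ≤-refl; n≤1+n; n<1+n)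
open import Data.Bool using (Bool; true; false; _∧_; _∨_)
open import Data.Fin using (Fin)
open import Data.Fin.Patterns using (0F; 1F; 2F; 3F)
import Data.Fin.Properties as Fin
open import Data.Vec using (Vec; []; _∷_; map)
open import Data.Vec.Properties using (∷-injectiveˡ; ∷-injectiveʳ)
open import Data.Product using (_,_; Σ-syntax)
open import Data.Sum using (inj₁; inj₂)
open import Data.Empty using (⊥-elim)
open import Relation.Nullary using (Dec; does; _because_; invert; ¬?; _×-dec_; _⊎-dec_; _→-dec_)
open import Relation.Nullary.Decidable using (map′)
open import Relation.Binary.PropositionalEquality using (refl; cong₂)

Colouring : ℕ → Set
Colouring n = Vec (Fin 4) n

colourClass : ∀ {n} → Colouring n → Fin 4 → Subset n
colourClass g c = map (λ x → does (x Fin.≟ c)) g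

cellColour : (x y z w : Bool) →
  x ∧ y ≡ false → x ∧ z ≡ false → x ∧ w ≡ false →
  y ∧ z ≡ false → y ∧ w ≡ false → z ∧ w ≡ false → x ∨ (y ∨ (z ∨ w)) ≡ true →
  Σ[ c ∈ Fin 4 ] (x ≡ does (c Fin.≟ 0F) × y ≡ does (c Fin.≟ 1F)
          × z ≡ does (c Fin.≟ 2F) × w ≡ does (c Fin.≟ 3F))
cellColour true  true  _     _     () _  _  _  _  _  _
cellColour true  _     true  _     _  () _  _  _  _  _
cellColour true  _     _     true  _  _  () _  _  _  _
cellColour true  false false false _  _  _  _  _  _  _  = 0F , refl , refl , refl , refl
cellColour false true  true  _     _  _  _  () _  _  _
cellColour false true  _     true  _  _  _  _  () _  _
cellColour false true  false false _  _  _  _  _  _  _  = 1F , refl , refl , refl , refl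
cellColour false false true  true  _  _  _  _  _  () _
cellColour false false true  false _  _  _  _  _  _  _  = 2F , refl , refl , refl , refl
cellColour false false false true  _  _  _  _  _  _  _  = 3F , refl , refl , refl , refl
cellColour false false false false _  _  _  _  _  _  ()

partition⇒colouring : ∀ n (X₁ X₂ X₃ X₄ : Subset n) →
  X₁ ∩ X₂ ≡ ⊥ → X₁ ∩ X₃ ≡ ⊥ → X₁ ∩ X₄ ≡ ⊥ →
  X₂ ∩ X₃ ≡ ⊥ → X₂ ∩ X₄ ≡ ⊥ → X₃ ∩ X₄ ≡ ⊥ → X₁ ∪ X₂ ∪ X₃ ∪ X₄ ≡ ⊤ →
  Σ[ g ∈ Colouring n ] (X₁ ≡ colourClass g 0F × X₂ ≡ colourClass g 1F
          × X₃ ≡ colourClass g 2F × X₄ ≡ colourClass g 3F)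
partition⇒colouring zero [] [] [] [] _ _ _ _ _ _ _ = [] , refl , refl , refl , refl
partition⇒colouring (suc n) (x ∷ X₁) (y ∷ X₂) (z ∷ X₃) (w ∷ X₄) d₁₂ d₁₃ d₁₄ d₂₃ d₂₄ d₃₄ cover =
  let (c , ex , ey , ez , ew) = cellColour x y z w
        (∷-injectiveˡ d₁₂) (∷-injectiveˡ d₁₃) (∷-injectiveˡ d₁₄)
        (∷-injectiveˡ d₂₃) (∷-injectiveˡ d₂₄) (∷-injectiveˡ d₃₄) (∷-injectiveˡ cover)
      (g , e₁ , e₂ , e₃ , e₄) = partition⇒colouring n X₁ X₂ X₃ X₄
        (∷-injectiveʳ d₁₂) (∷-injectiveʳ d₁₃) (∷-injectiveʳ d₁₄)
        (∷-injectiveʳ d₂₃) (∷-injectiveʳ d₂₄) (∷-injectiveʳ d₃₄) (∷-injectiveʳ cover)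
  in c ∷ g , cong₂ _∷_ ex e₁ , cong₂ _∷_ ey e₂ , cong₂ _∷_ ez e₃ , cong₂ _∷_ ew e₄

AllPairs : (ℕ → ℕ → Set) → Set
AllPairs P = (i j : ℕ) → 1 ≤ i → i < j → j ≤ 4 → P i j

Six : (ℕ → ℕ → Set) → Set
Six P = P 1 2 × P 1 3 × P 1 4 × P 2 3 × P 2 4 × P 3 4

six? : {P : ℕ → ℕ → Set} → ((i j : ℕ) → Dec (P i j)) → Dec (Six P)
six? P? = P? 1 2 ×-dec P? 1 3 ×-dec P? 1 4 ×-dec P? 2 3 ×-dec P? 2 4 ×-dec P? 3 4

-- Writing i = 1 + i′ and j = 2 + j′, the bounds say i′ ≤ j′ ≤ 2; matching
-- on these two proofs enumerates the six pairs.
six⇒allPairs : {P : ℕ → ℕ → Set} → Six P → AllPairs P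
six⇒allPairs (p₁₂ , p₁₃ , p₁₄ , p₂₃ , p₂₄ , p₃₄) = pick
  where
  pick : AllPairs _
  pick _ _ (s≤s z≤n) (s≤s (s≤s z≤n))             (s≤s (s≤s z≤n))                   = p₁₂
  pick _ _ (s≤s z≤n) (s≤s (s≤s z≤n))             (s≤s (s≤s (s≤s z≤n)))             = p₁₃
  pick _ _ (s≤s z≤n) (s≤s (s≤s z≤n))             (s≤s (s≤s (s≤s (s≤s z≤n))))       = p₁₄
  pick _ _ (s≤s z≤n) (s≤s (s≤s (s≤s z≤n)))       (s≤s (s≤s (s≤s z≤n)))             = p₂₃
  pick _ _ (s≤s z≤n) (s≤s (s≤s (s≤s z≤n)))       (s≤s (s≤s (s≤s (s≤s z≤n))))       = p₂₄
  pick _ _ (s≤s z≤n) (s≤s (s≤s (s≤s (s≤s z≤n)))) (s≤s (s≤s (s≤s (s≤s z≤n))))       = p₃₄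
  pick _ _ (s≤s z≤n) (s≤s (s≤s (s≤s (s≤s (s≤s _))))) (s≤s (s≤s (s≤s (s≤s ()))))

module Quadruple (X₁ X₂ X₃ X₄ : VSet) where

  E : ℕ → ℕ → ℕ
  E i j = e (part X₁ X₂ X₃ X₄ i) (part X₁ X₂ X₃ X₄ j)

  Joined : ℕ → ℕ → Set
  Joined i j = E i j > 0

  JoinedExcept : ℕ → ℕ → ℕ → ℕ → Set
  JoinedExcept α β i j = ¬ (i ≡ α × j ≡ β) → Joined i j

  Sorted : Set
  Sorted = ∣ X₁ ∣ ≥ ∣ X₂ ∣ × ∣ X₂ ∣ ≥ ∣ X₃ ∣ × ∣ X₃ ∣ ≥ ∣ X₄ ∣ × ∣ X₄ ∣ > 0

  EqualityCase : Set
  EqualityCase =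
    AllPairs Joined
    ⊎ (∣ X₁ ∣ ≡ 5 × ∃[ α ] ∃[ β ] (2 ≤ α × α < β × β ≤ 4 × E α β ≡ 0
                                  × AllPairs (JoinedExcept α β)))

  Conclusion : Set
  Conclusion = sumE X₁ X₂ X₃ X₄ ≥ 7 × (sumE X₁ X₂ X₃ X₄ ≡ 7 → EqualityCase)

  OnlyGapAt : ℕ → ℕ → Set
  OnlyGapAt α β = E α β ≡ 0 × Six (JoinedExcept α β)

  FiniteEqualityCase : Set
  FiniteEqualityCase =
    Six Joined ⊎ (∣ X₁ ∣ ≡ 5 × (OnlyGapAt 2 3 ⊎ OnlyGapAt 2 4 ⊎ OnlyGapAt 3 4))

  FiniteConclusion : Set
  FiniteConclusion = sumE X₁ X₂ X₃ X₄ ≥ 7 × (sumE X₁ X₂ X₃ X₄ ≡ 7 → FiniteEqualityCase)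

  sorted? : Dec Sorted
  sorted? = ∣ X₂ ∣ ≤? ∣ X₁ ∣ ×-dec ∣ X₃ ∣ ≤? ∣ X₂ ∣ ×-dec ∣ X₄ ∣ ≤? ∣ X₃ ∣ ×-dec 0 <? ∣ X₄ ∣

  finiteConclusion? : Dec FiniteConclusion
  finiteConclusion? = 7 ≤? sumE X₁ X₂ X₃ X₄ ×-dec (sumE X₁ X₂ X₃ X₄ ≟ 7 →-dec finiteEqualityCase?)
    where
    joined? : (i j : ℕ) → Dec (Joined i j)
    joined? i j = 0 <? E i j

    onlyGapAt? : (α β : ℕ) → Dec (OnlyGapAt α β)
    onlyGapAt? α β = E α β ≟ 0 ×-dec six? (λ i j → ¬? (i ≟ α ×-dec j ≟ β) →-dec joined? i j)

    finiteEqualityCase? : Dec FiniteEqualityCase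
    finiteEqualityCase? = six? joined? ⊎-dec
      (∣ X₁ ∣ ≟ 5 ×-dec (onlyGapAt? 2 3 ⊎-dec onlyGapAt? 2 4 ⊎-dec onlyGapAt? 3 4))

  excused : ∀ {α β} → JoinedExcept α β α β
  excused notExceptional = ⊥-elim (notExceptional (refl , refl))

  finite⇒equalityCase : FiniteEqualityCase → EqualityCase
  finite⇒equalityCase (inj₁ joined) = inj₁ (six⇒allPairs joined)
  finite⇒equalityCase (inj₂ (size , inj₁ (gap , j₁₂ , j₁₃ , j₁₄ , _ , j₂₄ , j₃₄))) =
    inj₂ (size , 2 , 3 , ≤-refl , n<1+n 2 , n≤1+n 3 , gap ,
          six⇒allPairs (j₁₂ , j₁₃ , j₁₄ , excused , j₂₄ , j₃₄))
  finite⇒equalityCase (inj₂ (size , inj₂ (inj₁ (gap , j₁₂ , j₁₃ , j₁₄ , j₂₃ , _ , j₃₄)))) =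
    inj₂ (size , 2 , 4 , ≤-refl , n≤1+n 3 , ≤-refl , gap ,
          six⇒allPairs (j₁₂ , j₁₃ , j₁₄ , j₂₃ , excused , j₃₄))
  finite⇒equalityCase (inj₂ (size , inj₂ (inj₂ (gap , j₁₂ , j₁₃ , j₁₄ , j₂₃ , j₂₄ , _)))) =
    inj₂ (size , 3 , 4 , n≤1+n 2 , ≤-refl , ≤-refl , gap ,
          six⇒allPairs (j₁₂ , j₁₃ , j₁₄ , j₂₃ , j₂₄ , excused))

  finite⇒conclusion : FiniteConclusion → Conclusion
  finite⇒conclusion (atLeast7 , equality) = atLeast7 , λ sum≡7 → finite⇒equalityCase (equality sum≡7)

allVectors? : ∀ {k} n {P : Vec (Fin k) n → Set} →
              ((g : Vec (Fin k) n) → Dec (P g)) → Dec ((g : Vec (Fin k) n) → P g)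
allVectors? zero P? = map′ (λ p → λ { [] → p }) (λ p → p []) (P? [])
allVectors? (suc n) P? =
  map′ (λ p → λ { (x ∷ g) → p x g }) (λ p x g → p (x ∷ g))
       (Fin.all? λ x → allVectors? n (λ g → P? (x ∷ g)))

-- Proof by reflection: a decision procedure that computes to true yields a
-- proof.  (Unlike toWitness, the hypothesis mentions does a? literally, so
-- the type checker evaluates the decision only once, in the proof of it.)
decidedTrue : {A : Set} (a? : Dec A) → does a? ≡ true → A
decidedTrue (true  because [a]) _ = invert [a]
decidedTrue (false because _)   ()

module Classes (g : Colouring 8) =
  Quadruple (colourClass g 0F) (colourClass g 1F) (colourClass g 2F) (colourClass g 3F)

colouringCheck : Dec ((g : Colouring 8) → Classes.Sorted g → Classes.FiniteConclusion g)
colouringCheck = allVectors? 8 (λ g → Classes.sorted? g →-dec Classes.finiteConclusion? g)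

colouringCheck-succeeds : does colouringCheck ≡ true
colouringCheck-succeeds = refl

everyColouringChecked : (g : Colouring 8) → Classes.Sorted g → Classes.FiniteConclusion g
everyColouringChecked = decidedTrue colouringCheck colouringCheck-succeeds

lemma2p8 : (X₁ X₂ X₃ X₄ : VSet) →
    X₁ ∩ X₂ ≡ ⊥ → X₁ ∩ X₃ ≡ ⊥ → X₁ ∩ X₄ ≡ ⊥ →
    X₂ ∩ X₃ ≡ ⊥ → X₂ ∩ X₄ ≡ ⊥ → X₃ ∩ X₄ ≡ ⊥ →
    X₁ ∪ X₂ ∪ X₃ ∪ X₄ ≡ ⊤ →
    ∣ X₁ ∣ ≥ ∣ X₂ ∣ → ∣ X₂ ∣ ≥ ∣ X₃ ∣ → ∣ X₃ ∣ ≥ ∣ X₄ ∣ → ∣ X₄ ∣ > 0 →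
    (sumE X₁ X₂ X₃ X₄ ≥ 7)
    × (sumE X₁ X₂ X₃ X₄ ≡ 7 →
        ((i j : ℕ) → 1 ≤ i → i < j → j ≤ 4 →
           e (part X₁ X₂ X₃ X₄ i) (part X₁ X₂ X₃ X₄ j) > 0)
        ⊎ (∣ X₁ ∣ ≡ 5
           × ∃[ α ] ∃[ β ] (2 ≤ α × α < β × β ≤ 4
               × e (part X₁ X₂ X₃ X₄ α) (part X₁ X₂ X₃ X₄ β) ≡ 0
               × ((i j : ℕ) → 1 ≤ i → i < j → j ≤ 4 → ¬ (i ≡ α × j ≡ β) →
                    e (part X₁ X₂ X₃ X₄ i) (part X₁ X₂ X₃ X₄ j) > 0))))
lemma2p8 X₁ X₂ X₃ X₄ d₁₂ d₁₃ d₁₄ d₂₃ d₂₄ d₃₄ cover s₁₂ s₂₃ s₃₄ s₄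
  with partition⇒colouring 8 X₁ X₂ X₃ X₄ d₁₂ d₁₃ d₁₄ d₂₃ d₂₄ d₃₄ cover
... | g , refl , refl , refl , refl =
  Classes.finite⇒conclusion g (everyColouringChecked g (s₁₂ , s₂₃ , s₃₄ , s₄))
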